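{- Let $X$ be a set and let $(f_i)_{i\in I}$ be a family of complementary choice functions on $X$. Then the choice function $f=\bigcup_i f_i$, defined by $f(A)=\bigcup_{i\in I} f_i(A)$, is complementary.
   Context: A choice function (CF) on $X$ is a map $f:2^X\to 2^X$ with $f(A)\subseteq A$ for all $A\subseteq X$. A CF is consistent if $f(A)\subseteq B\subseteq A$ implies $f(B)=f(A)$; monotonic if $A\subseteq B$ implies $f(A)\subseteq f(B)$; complementary if it is consistent and monotonic. -}

module Defs where

open import Level using (0ℓ)
open import Data.Product using (Σ; _,_)
open import Relation.Unary using (Pred; _⊆_; _≐_; ⋃)

-- Subsets of X are predicates X → Set (the power set 2^X is Pred X 0ℓ).
-- Equality of subsets is extensional equality _≐_ (mutual inclusion).
Subset : Set → Set₁
Subset X = Pred X 0ℓ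

record ChoiceFunction (X : Set) : Set₁ where
  field
    apply     : Subset X → Subset X
    contained : ∀ (A : Subset X) → apply A ⊆ A
open ChoiceFunction public

Consistent : {X : Set} → ChoiceFunction X → Set₁
Consistent {X} f = ∀ (A B : Subset X) → apply f A ⊆ B → B ⊆ A → apply f B ≐ apply f A

Monotonic : {X : Set} → ChoiceFunction X → Set₁
Monotonic {X} f = ∀ (A B : Subset X) → A ⊆ B → apply f A ⊆ apply f B

record Complementary {X : Set} (f : ChoiceFunction X) : Set₁ where
  field
    consistent : Consistent f
    monotonic  : Monotonic f

⋃CF : {X : Set} (I : Set) → (I → ChoiceFunction X) → ChoiceFunction X
⋃CF I fs = record
  { apply     = λ A → ⋃ I (λ i → apply (fs i) A)
  ; contained = λ A → λ { (i , p) → contained (fs i) A p }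
  }

module Submission where

open import Defs
open import Data.Product using (_,_; proj₁; proj₂)
open import Relation.Unary using (_≐_)

module _ {X : Set} (I : Set) (fs : I → ChoiceFunction X) where

  ⋃CF-monotonic : (∀ i → Monotonic (fs i)) → Monotonic (⋃CF I fs)
  ⋃CF-monotonic mono A B A⊆B (i , x∈fᵢA) = i , mono i A B A⊆B x∈fᵢA

  -- f(A) ⊆ B gives fᵢ(A) ⊆ B for every i, so each fᵢ is constant between B and A.
  ⋃CF-consistent : (∀ i → Consistent (fs i)) → Consistent (⋃CF I fs)
  ⋃CF-consistent cons A B fA⊆B B⊆A =
      (λ { (i , x∈fᵢB) → i , proj₁ (fᵢB≐fᵢA i) x∈fᵢB })
    , (λ { (i , x∈fᵢA) → i , proj₂ (fᵢB≐fᵢA i) x∈fᵢA })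
    where
    fᵢB≐fᵢA : ∀ i → apply (fs i) B ≐ apply (fs i) A
    fᵢB≐fᵢA i = cons i A B (λ x∈fᵢA → fA⊆B (i , x∈fᵢA)) B⊆A

proposition1 : (X : Set) (I : Set) (fs : I → ChoiceFunction X) →
    (∀ i → Complementary (fs i)) → Complementary (⋃CF I fs)
proposition1 X I fs comp = record
  { consistent = ⋃CF-consistent I fs (λ i → Complementary.consistent (comp i))
  ; monotonic  = ⋃CF-monotonic I fs (λ i → Complementary.monotonic (comp i))
  }
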